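{- Let $M$ be a primitive non-deficient number with at least four distinct prime factors. Suppose that $3\mid M$, $5\mid M$ and $7\mid M$. Then either $3\,\|\,M$ or $3^2\,\|\,M$. Moreover, if $3^2\,\|\,M$ then $5\,\|\,M$ and $7\,\|\,M$.
   Context: $\sigma(n)$ is the sum of the positive divisors of $n$. A positive integer $n$ is deficient if $\sigma(n)<2n$. A positive integer $M$ is a primitive non-deficient number if $M$ is not deficient but every proper divisor of $M$ is deficient. For a prime power $p^a$, $p^a\,\|\,M$ means $p^a\mid M$ but $p^{a+1}\nmid M$. -}

module Defs where

open import Data.Nat using (ℕ; zero; suc; _+_; _*_; _^_; _<_; _≥_)
open import Data.Nat.Divisibility using (_∣_; _∣?_)
open import Data.Nat.Primality using (Prime)
open import Data.List using (List; filter; map)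
open import Data.Nat.ListAction using (sum)
open import Data.List.Base using (upTo)
open import Data.Product using (_×_; ∃)
open import Relation.Binary.PropositionalEquality using (_≢_)
open import Relation.Nullary using (¬_)

range1 : ℕ → List ℕ
range1 n = map suc (upTo n)

-- σ(n) = sum of the positive divisors of n (σ(0) = 0, irrelevant here).
σ : ℕ → ℕ
σ n = sum (filter (λ d → d ∣? n) (range1 n))

Deficient : ℕ → Set
Deficient n = σ n < 2 * n

PrimitiveNonDeficient : ℕ → Set
PrimitiveNonDeficient M =
  (0 < M) × (¬ Deficient M) ×
  (∀ d → 0 < d → d ∣ M → d ≢ M → Deficient d)

_∥_ : ℕ → ℕ → ℕ → Set
(p ∥ a) M = (p ^ a ∣ M) × ¬ (p ^ suc a ∣ M)

AtLeastFourPrimeFactors : ℕ → Set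
AtLeastFourPrimeFactors M =
  ∃ λ p → ∃ λ q → ∃ λ r → ∃ λ s →
    Prime p × Prime q × Prime r × Prime s ×
    p ∣ M × q ∣ M × r ∣ M × s ∣ M ×
    p ≢ q × p ≢ r × p ≢ s × q ≢ r × q ≢ s × r ≢ s

{-# OPTIONS --safe #-}
-- A non-deficient divisor of a primitive non-deficient M is M itself. The numbers
-- 3³·5·7 = 945, 3²·5²·7 = 1575 and 3²·5·7² = 2205 are non-deficient, so none of
-- them divides M: otherwise M would be one of them and have only the three prime
-- factors 3, 5, 7. Excluding 945 forbids 3³ ∣ M; if 3² ∣ M, excluding 1575 and
-- 2205 forbids 5² ∣ M and 7² ∣ M.
module Submission where

open import Defs
open import Data.Nat using (ℕ)
open import Data.Nat.Divisibility using (_∣_)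
open import Data.Product using (_×_)
open import Data.Sum using (_⊎_)

open import Data.Nat using (zero; suc; _*_; _^_; _<_; _<?_; _≟_; z≤n; s≤s)
open import Data.Nat.Properties using (≤-refl)
open import Data.Nat.Base using (nonTrivial⇒≢1)
open import Data.Nat.Divisibility using (_∣?_; ∣1⇒≡1; 0∣⇒≡0)
open import Data.Nat.LCM using (lcm-least)
open import Data.Nat.Primality using (Prime; prime?; euclidsLemma; prime⇒irreducible; prime⇒nonTrivial)
open import Data.Fin as Fin using (Fin; zero; suc)
open import Data.Fin.Properties using (pigeonhole)
open import Data.List as List using (List; []; _∷_; length)
open import Data.List.Membership.Propositional using (_∈_)
open import Data.List.Relation.Unary.Any using (here; there; index)
open import Data.List.Relation.Unary.Any.Properties using (lookup-index)
open import Data.Vec using (Vec; lookup) renaming ([] to []ᵥ; _∷_ to _∷ᵥ_)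
open import Data.Product using (_,_; ∃₂)
open import Data.Sum using (inj₁; inj₂)
open import Data.Empty using (⊥-elim)
open import Function using (_∘_)
open import Relation.Nullary using (¬_; yes; no)
open import Relation.Nullary.Decidable using (from-yes; from-no)
open import Relation.Binary.PropositionalEquality using (_≡_; _≢_; refl; sym; trans; cong; subst)

prime≢1 : ∀ {p} → Prime p → p ≢ 1
prime≢1 p-prime = nonTrivial⇒≢1 {{prime⇒nonTrivial p-prime}}

prime∣prime⇒≡ : ∀ {p q} → Prime p → Prime q → p ∣ q → p ≡ q
prime∣prime⇒≡ p-prime q-prime p∣q with prime⇒irreducible q-prime p∣q
... | inj₁ p≡1 = ⊥-elim (prime≢1 p-prime p≡1)
... | inj₂ p≡q = p≡q

prime∣prime^⇒≡ : ∀ {p q} a → Prime p → Prime q → p ∣ q ^ a → p ≡ q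
prime∣prime^⇒≡ zero    p-prime q-prime p∣1 = ⊥-elim (prime≢1 p-prime (∣1⇒≡1 p∣1))
prime∣prime^⇒≡ {q = q} (suc a) p-prime q-prime p∣q^[1+a]
  with euclidsLemma q (q ^ a) p-prime p∣q^[1+a]
... | inj₁ p∣q   = prime∣prime⇒≡ p-prime q-prime p∣q
... | inj₂ p∣q^a = prime∣prime^⇒≡ a p-prime q-prime p∣q^a

prime[3] : Prime 3
prime[3] = from-yes (prime? 3)

prime[5] : Prime 5
prime[5] = from-yes (prime? 5)

prime[7] : Prime 7
prime[7] = from-yes (prime? 7)

prime∣3^a*5^b*7^c⇒∈ : ∀ {p} a b c → Prime p → p ∣ 3 ^ a * 5 ^ b * 7 ^ c →
                      p ∈ 3 ∷ 5 ∷ 7 ∷ []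
prime∣3^a*5^b*7^c⇒∈ a b c p-prime p∣n
  with euclidsLemma (3 ^ a * 5 ^ b) (7 ^ c) p-prime p∣n
... | inj₂ p∣7^c = there (there (here (prime∣prime^⇒≡ c p-prime prime[7] p∣7^c)))
... | inj₁ p∣3^a*5^b with euclidsLemma (3 ^ a) (5 ^ b) p-prime p∣3^a*5^b
...   | inj₁ p∣3^a = here (prime∣prime^⇒≡ a p-prime prime[3] p∣3^a)
...   | inj₂ p∣5^b = there (here (prime∣prime^⇒≡ b p-prime prime[5] p∣5^b))

pigeonhole-∈ : ∀ {a} {A : Set a} {n} (xs : List A) (v : Fin n → A) → length xs < n →
               (∀ i → v i ∈ xs) → ∃₂ λ i j → i Fin.< j × v i ≡ v j
pigeonhole-∈ xs v |xs|<n v∈xs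
  with i , j , i<j , index≡ ← pigeonhole |xs|<n (index ∘ v∈xs)
  = i , j , i<j , trans (lookup-index (v∈xs i))
                        (trans (cong (List.lookup xs) index≡) (sym (lookup-index (v∈xs j))))

fourPrimeFactors⇒¬⊆ : ∀ {M} (xs : List ℕ) → length xs < 4 → AtLeastFourPrimeFactors M →
                      ¬ (∀ {p} → Prime p → p ∣ M → p ∈ xs)
fourPrimeFactors⇒¬⊆ xs |xs|<4
  (p , q , r , s , p-prime , q-prime , r-prime , s-prime , p∣M , q∣M , r∣M , s∣M ,
   p≢q , p≢r , p≢s , q≢r , q≢s , r≢s) primes∈xs
  = let i , j , i<j , ps[i]≡ps[j] = pigeonhole-∈ xs (lookup ps) |xs|<4 ps∈xs
    in distinct i<j ps[i]≡ps[j]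
  where
  ps : Vec ℕ 4
  ps = p ∷ᵥ q ∷ᵥ r ∷ᵥ s ∷ᵥ []ᵥ

  ps∈xs : ∀ i → lookup ps i ∈ xs
  ps∈xs zero                   = primes∈xs p-prime p∣M
  ps∈xs (suc zero)             = primes∈xs q-prime q∣M
  ps∈xs (suc (suc zero))       = primes∈xs r-prime r∣M
  ps∈xs (suc (suc (suc zero))) = primes∈xs s-prime s∣M

  distinct : ∀ {i j} → i Fin.< j → lookup ps i ≢ lookup ps j
  distinct {_}                   {zero}                    ()
  distinct {zero}                {suc zero}                _ = p≢q
  distinct {suc _}               {suc zero}                (s≤s ())
  distinct {zero}                {suc (suc zero)}          _ = p≢r
  distinct {suc zero}            {suc (suc zero)}          _ = q≢r
  distinct {suc (suc _)}         {suc (suc zero)}          (s≤s (s≤s ()))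
  distinct {zero}                {suc (suc (suc zero))}    _ = p≢s
  distinct {suc zero}            {suc (suc (suc zero))}    _ = q≢s
  distinct {suc (suc zero)}      {suc (suc (suc zero))}    _ = r≢s
  distinct {suc (suc (suc _))}   {suc (suc (suc zero))}    (s≤s (s≤s (s≤s ())))

divisor>0 : ∀ {d M} → 0 < M → d ∣ M → 0 < d
divisor>0 {zero}  0<M 0∣M = subst (0 <_) (0∣⇒≡0 0∣M) 0<M
divisor>0 {suc _} _   _   = s≤s z≤n

nonDeficient-divisor⇒≡ : ∀ {M d} → PrimitiveNonDeficient M → d ∣ M → ¬ Deficient d → d ≡ M
nonDeficient-divisor⇒≡ {M} {d} (0<M , _ , proper⇒deficient) d∣M d-nonDeficient with d ≟ M
... | yes d≡M = d≡M
... | no  d≢M = ⊥-elim (d-nonDeficient (proper⇒deficient d (divisor>0 0<M d∣M) d∣M d≢M))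

nonDeficient-3^a*5^b*7^c∤ : ∀ {M} a b c → PrimitiveNonDeficient M → AtLeastFourPrimeFactors M →
                            ¬ Deficient (3 ^ a * 5 ^ b * 7 ^ c) → ¬ (3 ^ a * 5 ^ b * 7 ^ c ∣ M)
nonDeficient-3^a*5^b*7^c∤ a b c pnd four n-nonDeficient n∣M
  with refl ← nonDeficient-divisor⇒≡ pnd n∣M n-nonDeficient
  = fourPrimeFactors⇒¬⊆ (3 ∷ 5 ∷ 7 ∷ []) ≤-refl four (prime∣3^a*5^b*7^c⇒∈ a b c)

nonDeficient[945] : ¬ Deficient 945
nonDeficient[945] = from-no (σ 945 <? 2 * 945)

nonDeficient[1575] : ¬ Deficient 1575
nonDeficient[1575] = from-no (σ 1575 <? 2 * 1575)

nonDeficient[2205] : ¬ Deficient 2205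
nonDeficient[2205] = from-no (σ 2205 <? 2 * 2205)

lemma8 : (M : ℕ) → PrimitiveNonDeficient M → AtLeastFourPrimeFactors M →
           3 ∣ M → 5 ∣ M → 7 ∣ M →
           ((3 ∥ 1) M ⊎ (3 ∥ 2) M) × ((3 ∥ 2) M → (5 ∥ 1) M × (7 ∥ 1) M)
lemma8 M pnd four 3∣M 5∣M 7∣M = 3∥1⊎3²∥ , 3²∥⇒5∥1×7∥1
  where
  excluded : ∀ a b c → ¬ Deficient (3 ^ a * 5 ^ b * 7 ^ c) → ¬ (3 ^ a * 5 ^ b * 7 ^ c ∣ M)
  excluded a b c = nonDeficient-3^a*5^b*7^c∤ a b c pnd four

  3∥1⊎3²∥ : (3 ∥ 1) M ⊎ (3 ∥ 2) M
  3∥1⊎3²∥ with 9 ∣? M | 27 ∣? M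
  ... | no  9∤M | _        = inj₁ (3∣M , 9∤M)
  ... | yes 9∣M | no  27∤M = inj₂ (9∣M , 27∤M)
  -- lcm 27 (lcm 5 7) normalises to 945 = 3 ^ 3 * 5 ^ 1 * 7 ^ 1.
  ... | yes _   | yes 27∣M =
    ⊥-elim (excluded 3 1 1 nonDeficient[945] (lcm-least 27∣M (lcm-least 5∣M 7∣M)))

  3²∥⇒5∥1×7∥1 : (3 ∥ 2) M → (5 ∥ 1) M × (7 ∥ 1) M
  3²∥⇒5∥1×7∥1 (9∣M , _) = (5∣M , 25∤M) , (7∣M , 49∤M)
    where
    25∤M : ¬ (25 ∣ M)
    25∤M 25∣M = excluded 2 2 1 nonDeficient[1575] (lcm-least 9∣M (lcm-least 25∣M 7∣M))

    49∤M : ¬ (49 ∣ M)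
    49∤M 49∣M = excluded 2 1 2 nonDeficient[2205] (lcm-least 9∣M (lcm-least 5∣M 49∣M))
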